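{- For $n\le m$, $d_{\mathrm{EQ}}(n,m)=\Omega(n/\log m)$, where $\mathrm{EQ}\colon\{0,1\}^n\times\{0,1\}^n\to\{0,1\}$ is the equality function ($\mathrm{EQ}(x,y)=1$ iff $x=y$).
   Context: For a function $f\colon\{0,1\}^n\times\{0,1\}^n\to\{0,1\}$, $d_f(n,m)$ is the least degree of a polynomial $\mathrm{Carol}$ over $\mathbb{F}_2$ (in $2m$ variables) such that there exist functions $\mathrm{Alice},\mathrm{Bob}\colon\{0,1\}^n\to\{0,1\}^m$ with $f(x,y)=\mathrm{Carol}(\mathrm{Alice}(x),\mathrm{Bob}(y))$ for all $x,y\in\{0,1\}^n$. -}

module Defs where

open import Data.Bool using (Bool; true; false; _xor_; _∧_; not; _∨_)
open import Data.Bool.Properties using () renaming (_≟_ to _≟B_)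
open import Data.Nat using (ℕ; zero; suc; _+_; _≤_)
open import Data.Vec using (Vec; []; _∷_; _++_)
open import Data.Vec.Properties using (≡-dec)
open import Data.List using (List; foldr)
open import Data.List.Relation.Unary.All using (All)
open import Data.Product using (Σ; _×_)
open import Relation.Nullary.Decidable using (⌊_⌋)
open import Relation.Binary.PropositionalEquality using (_≡_)

-- Bit strings {0,1}^n, with F₂ = Bool (xor = +, ∧ = ·).
Bits : ℕ → Set
Bits n = Vec Bool n

EQ : (n : ℕ) → Bits n → Bits n → Bool
EQ n x y = ⌊ ≡-dec _≟B_ x y ⌋

-- A monomial in k variables over F₂ (multilinear, since x² = x on {0,1}):
-- the set of variables it contains, as a characteristic vector.
Monomial : ℕ → Set
Monomial k = Vec Bool k

Poly : ℕ → Set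
Poly k = List (Monomial k)

monDeg : ∀ {k} → Monomial k → ℕ
monDeg [] = 0
monDeg (true ∷ s) = suc (monDeg s)
monDeg (false ∷ s) = monDeg s

DegreeAtMost : ∀ {k} → ℕ → Poly k → Set
DegreeAtMost d p = All (λ s → monDeg s ≤ d) p

evalMon : ∀ {k} → Monomial k → Bits k → Bool
evalMon [] [] = true
evalMon (b ∷ s) (z ∷ zs) = (not b ∨ z) ∧ evalMon s zs

evalPoly : ∀ {k} → Poly k → Bits k → Bool
evalPoly p z = foldr (λ s acc → evalMon s z xor acc) false p

Realizable : (n m d : ℕ) → (Bits n → Bits n → Bool) → Set
Realizable n m d f =
  Σ (Bits n → Bits m) λ alice →
  Σ (Bits n → Bits m) λ bob →
  Σ (Poly (m + m)) λ carol →
    DegreeAtMost d carol ×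
    (∀ x y → f x y ≡ evalPoly carol (alice x ++ bob y))

IsDf : (n m : ℕ) → (Bits n → Bits n → Bool) → ℕ → Set
IsDf n m f d = Realizable n m d f × (∀ d′ → Realizable n m d′ f → d ≤ d′)

{-# OPTIONS --safe #-}
-- Over F₂ the matrix of EQ is the identity, so every χ : {0,1}ⁿ → F₂ equals its own
-- row χ·EQ: χ(y) = Σₓ χ(x) EQ(x,y). Substituting EQ(x,y) = Carol(Alice x, Bob y) and
-- splitting each monomial of Carol into an Alice part t and a Bob part u gives
--   χ(y) = Σ_{t·u ∈ Carol} (Σₓ χ(x) t(Alice x)) · u(Bob y),
-- so χ is determined by its moments Σₓ χ(x) t(Alice x) for the at most (m+1)^d
-- monomials t of degree ≤ d in m variables. Counting the 2^(2ⁿ) functions χ yields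
-- 2ⁿ ≤ (m+1)^d, that is n ≤ d log₂(m+1).

module Submission where

open import Defs
open import Data.Nat using (ℕ; _+_; _*_; _≤_)
open import Data.Nat.Logarithm using (⌊log₂_⌋)
open import Data.Product using (Σ)

open import Algebra.Bundles using (CommutativeRing)
open import Data.Bool using (Bool; true; false; _xor_; _∧_)
open import Data.Bool.Properties
  using (xor-∧-commutativeRing; xor-identityʳ; ∧-assoc; ∧-identityʳ; ∧-zeroʳ
        ; ∧-distribˡ-xor; ∧-distribʳ-xor)
open import Data.Fin using (Fin; zero; suc; combine; funToFin; finToFun)
open import Data.Fin.Properties
  using (2↔Bool; funToFin-finToFin; finToFun-funToFin; injective⇒≤)
open import Data.List using (List; []; _∷_; foldr; length; map; lookup) renaming (_++_ to _++ˡ_)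
open import Data.List.Properties using (length-map; length-++)
open import Data.List.Membership.Propositional using (_∈_)
open import Data.List.Membership.Propositional.Properties using (∈-map⁺; ∈-++⁺ˡ; ∈-++⁺ʳ)
open import Data.List.Relation.Unary.All as All using (All; []; _∷_)
open import Data.List.Relation.Unary.Any using (here; index)
open import Data.List.Relation.Unary.Any.Properties using (lookup-index)
open import Data.Nat using (zero; suc; _^_; s≤s)
open import Data.Nat.Logarithm using (⌊log₂⌋-mono-≤; ⌊log₂[2^n]⌋≡n)
open import Data.Nat.Properties
open import Data.Product using (_,_)
open import Data.Vec using ([]; _∷_; _++_; take; drop; tabulate)
  renaming (lookup to lookupᵛ)
open import Data.Vec.Properties using (≡-dec; ∷-injectiveʳ; take++drop≡id; lookup∘tabulate)
open import Function using (_∘_; Inverse)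
open import Relation.Binary.PropositionalEquality
open import Relation.Nullary using (yes; no; contradiction)
open import Relation.Nullary.Decidable using (isYes≗does; dec-true; dec-false)

open import Algebra.Properties.CommutativeSemigroup
  (CommutativeRing.+-commutativeSemigroup xor-∧-commutativeRing) using (interchange)

private
  variable
    A : Set
    a b k l n m d : ℕ

sumBits : ∀ n → (Bits n → Bool) → Bool
sumBits zero    f = f []
sumBits (suc n) f = sumBits n (f ∘ (true ∷_)) xor sumBits n (f ∘ (false ∷_))

sumBits-cong : ∀ n {f g : Bits n → Bool} → (∀ x → f x ≡ g x) → sumBits n f ≡ sumBits n g
sumBits-cong zero    f≗g = f≗g []
sumBits-cong (suc n) f≗g =
  cong₂ _xor_ (sumBits-cong n (f≗g ∘ (true ∷_))) (sumBits-cong n (f≗g ∘ (false ∷_)))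

sumBits-zero : ∀ n {f : Bits n → Bool} → (∀ x → f x ≡ false) → sumBits n f ≡ false
sumBits-zero n f≗0 = trans (sumBits-cong n f≗0) (sumBits-false n)
  where
  sumBits-false : ∀ n → sumBits n (λ _ → false) ≡ false
  sumBits-false zero    = refl
  sumBits-false (suc n) = cong₂ _xor_ (sumBits-false n) (sumBits-false n)

sumBits-xor : ∀ n (f g : Bits n → Bool) →
  sumBits n (λ x → f x xor g x) ≡ sumBits n f xor sumBits n g
sumBits-xor zero    f g = refl
sumBits-xor (suc n) f g = trans
  (cong₂ _xor_ (sumBits-xor n (f ∘ (true ∷_)) (g ∘ (true ∷_)))
               (sumBits-xor n (f ∘ (false ∷_)) (g ∘ (false ∷_))))
  (interchange (sumBits n (f ∘ (true ∷_))) (sumBits n (g ∘ (true ∷_)))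
               (sumBits n (f ∘ (false ∷_))) (sumBits n (g ∘ (false ∷_))))

sumBits-∧ʳ : ∀ n (f : Bits n → Bool) c → sumBits n (λ x → f x ∧ c) ≡ sumBits n f ∧ c
sumBits-∧ʳ zero    f c = refl
sumBits-∧ʳ (suc n) f c = trans
  (cong₂ _xor_ (sumBits-∧ʳ n (f ∘ (true ∷_)) c) (sumBits-∧ʳ n (f ∘ (false ∷_)) c))
  (sym (∧-distribʳ-xor c (sumBits n (f ∘ (true ∷_))) (sumBits n (f ∘ (false ∷_)))))

sumBits-single : ∀ n (f : Bits n → Bool) y → (∀ x → x ≢ y → f x ≡ false) → sumBits n f ≡ f y
sumBits-single zero    f [] _ = refl
sumBits-single (suc n) f (true ∷ y) f≗0 = begin
  sumBits n (f ∘ (true ∷_)) xor sumBits n (f ∘ (false ∷_))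
    ≡⟨ cong₂ _xor_ (sumBits-single n _ y (λ x x≢y → f≗0 _ (x≢y ∘ ∷-injectiveʳ)))
                   (sumBits-zero n (λ x → f≗0 _ λ ())) ⟩
  f (true ∷ y) xor false
    ≡⟨ xor-identityʳ _ ⟩
  f (true ∷ y) ∎
  where open ≡-Reasoning
sumBits-single (suc n) f (false ∷ y) f≗0 =
  cong₂ _xor_ (sumBits-zero n (λ x → f≗0 _ λ ()))
              (sumBits-single n _ y (λ x x≢y → f≗0 _ (x≢y ∘ ∷-injectiveʳ)))

EQ-refl : ∀ n (x : Bits n) → EQ n x x ≡ true
EQ-refl n x = trans (isYes≗does (≡-dec _ x x)) (dec-true (≡-dec _ x x) refl)

EQ-≢ : ∀ n {x y : Bits n} → x ≢ y → EQ n x y ≡ false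
EQ-≢ n {x} {y} x≢y = trans (isYes≗does (≡-dec _ x y)) (dec-false (≡-dec _ x y) x≢y)

sumBits-EQ : ∀ n (χ : Bits n → Bool) y → sumBits n (λ x → χ x ∧ EQ n x y) ≡ χ y
sumBits-EQ n χ y = begin
  sumBits n (λ x → χ x ∧ EQ n x y)
    ≡⟨ sumBits-single n _ y (λ x x≢y → trans (cong (χ x ∧_) (EQ-≢ n x≢y)) (∧-zeroʳ (χ x))) ⟩
  χ y ∧ EQ n y y
    ≡⟨ cong (χ y ∧_) (EQ-refl n y) ⟩
  χ y ∧ true
    ≡⟨ ∧-identityʳ (χ y) ⟩
  χ y ∎
  where open ≡-Reasoning

sumList : List A → (A → Bool) → Bool
sumList ss f = foldr (λ s acc → f s xor acc) false ss

sumList-cong : ∀ (ss : List A) {f g : A → Bool} → All (λ s → f s ≡ g s) ss →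
  sumList ss f ≡ sumList ss g
sumList-cong []       []            = refl
sumList-cong (s ∷ ss) (fs≡gs ∷ eqs) = cong₂ _xor_ fs≡gs (sumList-cong ss eqs)

∧-distribˡ-sumList : ∀ c (ss : List A) (f : A → Bool) →
  c ∧ sumList ss f ≡ sumList ss (λ s → c ∧ f s)
∧-distribˡ-sumList c []       f = ∧-zeroʳ c
∧-distribˡ-sumList c (s ∷ ss) f =
  trans (∧-distribˡ-xor c (f s) (sumList ss f)) (cong (c ∧ f s xor_) (∧-distribˡ-sumList c ss f))

sumBits-sumList : ∀ n (ss : List A) (f : Bits n → A → Bool) →
  sumBits n (λ x → sumList ss (f x)) ≡ sumList ss (λ s → sumBits n (λ x → f x s))
sumBits-sumList n []       f = sumBits-zero n (λ _ → refl)
sumBits-sumList n (s ∷ ss) f =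
  trans (sumBits-xor n (λ x → f x s) (λ x → sumList ss (f x)))
        (cong (sumBits n (λ x → f x s) xor_) (sumBits-sumList n ss f))

evalMon-++ : ∀ (s : Monomial k) (t : Monomial l) x y →
  evalMon (s ++ t) (x ++ y) ≡ evalMon s x ∧ evalMon t y
evalMon-++ []      t []      y = refl
evalMon-++ (b ∷ s) t (z ∷ x) y =
  trans (cong (_ ∧_) (evalMon-++ s t x y)) (sym (∧-assoc _ (evalMon s x) (evalMon t y)))

monDeg-++ : ∀ (s : Monomial k) (t : Monomial l) → monDeg (s ++ t) ≡ monDeg s + monDeg t
monDeg-++ []          t = refl
monDeg-++ (true ∷ s)  t = cong suc (monDeg-++ s t)
monDeg-++ (false ∷ s) t = monDeg-++ s t

monDeg-take : ∀ k (s : Monomial (k + l)) → monDeg (take k s) ≤ monDeg s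
monDeg-take k s = begin
  monDeg (take k s)                        ≤⟨ m≤m+n _ _ ⟩
  monDeg (take k s) + monDeg (drop k s)    ≡⟨ monDeg-++ (take k s) (drop k s) ⟨
  monDeg (take k s ++ drop k s)            ≡⟨ cong monDeg (take++drop≡id k s) ⟩
  monDeg s                                 ∎
  where open ≤-Reasoning

moment : (Bits n → Bool) → (Bits n → Bits k) → Monomial k → Bool
moment {n} χ α t = sumBits n (λ x → χ x ∧ evalMon t (α x))

sumBits-evalPoly : ∀ n (χ : Bits n → Bool) (α : Bits n → Bits k) (y : Bits l)
  (p : Poly (k + l)) →
  sumBits n (λ x → χ x ∧ evalPoly p (α x ++ y)) ≡
  sumList p (λ s → moment χ α (take k s) ∧ evalMon (drop k s) y)
sumBits-evalPoly {k} n χ α y p = begin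
  sumBits n (λ x → χ x ∧ evalPoly p (α x ++ y))
    ≡⟨ sumBits-cong n (λ x → ∧-distribˡ-sumList (χ x) p (λ s → evalMon s (α x ++ y))) ⟩
  sumBits n (λ x → sumList p (λ s → χ x ∧ evalMon s (α x ++ y)))
    ≡⟨ sumBits-sumList n p _ ⟩
  sumList p (λ s → sumBits n (λ x → χ x ∧ evalMon s (α x ++ y)))
    ≡⟨ sumList-cong p (All.universal monomial-term p) ⟩
  sumList p (λ s → moment χ α (take k s) ∧ evalMon (drop k s) y) ∎
  where
  open ≡-Reasoning
  split : ∀ s x → evalMon s (α x ++ y) ≡ evalMon (take k s) (α x) ∧ evalMon (drop k s) y
  split s x = trans (cong (λ s′ → evalMon s′ (α x ++ y)) (sym (take++drop≡id k s)))
                    (evalMon-++ (take k s) (drop k s) (α x) y)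
  monomial-term : ∀ s → sumBits n (λ x → χ x ∧ evalMon s (α x ++ y)) ≡
                        moment χ α (take k s) ∧ evalMon (drop k s) y
  monomial-term s = trans
    (sumBits-cong n (λ x → trans (cong (χ x ∧_) (split s x)) (sym (∧-assoc (χ x) _ _))))
    (sumBits-∧ʳ n _ _)

module _ (alice bob : Bits n → Bits m) (carol : Poly (m + m))
         (carol-deg : DegreeAtMost d carol)
         (EQ-carol : ∀ x y → EQ n x y ≡ evalPoly carol (alice x ++ bob y)) where

  EQ-row : ∀ (χ : Bits n → Bool) y →
    χ y ≡ sumList carol (λ s → moment χ alice (take m s) ∧ evalMon (drop m s) (bob y))
  EQ-row χ y = begin
    χ y
      ≡⟨ sumBits-EQ n χ y ⟨
    sumBits n (λ x → χ x ∧ EQ n x y)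
      ≡⟨ sumBits-cong n (λ x → cong (χ x ∧_) (EQ-carol x y)) ⟩
    sumBits n (λ x → χ x ∧ evalPoly carol (alice x ++ bob y))
      ≡⟨ sumBits-evalPoly n χ alice (bob y) carol ⟩
    sumList carol (λ s → moment χ alice (take m s) ∧ evalMon (drop m s) (bob y)) ∎
    where open ≡-Reasoning

  low-moments-determine : ∀ (χ χ′ : Bits n → Bool) →
    (∀ t → monDeg t ≤ d → moment χ alice t ≡ moment χ′ alice t) → ∀ y → χ y ≡ χ′ y
  low-moments-determine χ χ′ same y = begin
    χ y
      ≡⟨ EQ-row χ y ⟩
    sumList carol (λ s → moment χ alice (take m s) ∧ evalMon (drop m s) (bob y))
      ≡⟨ sumList-cong carol (All.map same-term carol-deg) ⟩
    sumList carol (λ s → moment χ′ alice (take m s) ∧ evalMon (drop m s) (bob y))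
      ≡⟨ EQ-row χ′ y ⟨
    χ′ y ∎
    where
    open ≡-Reasoning
    same-term : ∀ {s} → monDeg s ≤ d →
      moment χ alice (take m s) ∧ evalMon (drop m s) (bob y) ≡
      moment χ′ alice (take m s) ∧ evalMon (drop m s) (bob y)
    same-term {s} s≤d =
      cong (_∧ evalMon (drop m s) (bob y)) (same (take m s) (≤-trans (monDeg-take m s) s≤d))

monomials≤ : ∀ m → ℕ → List (Monomial m)
monomials≤ zero    d       = [] ∷ []
monomials≤ (suc m) zero    = map (false ∷_) (monomials≤ m zero)
monomials≤ (suc m) (suc d) =
  map (false ∷_) (monomials≤ m (suc d)) ++ˡ map (true ∷_) (monomials≤ m d)

∈-monomials≤ : ∀ m d (t : Monomial m) → monDeg t ≤ d → t ∈ monomials≤ m d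
∈-monomials≤ zero    d       []          _         = here refl
∈-monomials≤ (suc m) zero    (false ∷ t) t≤d       = ∈-map⁺ (false ∷_) (∈-monomials≤ m zero t t≤d)
∈-monomials≤ (suc m) (suc d) (false ∷ t) t≤d       =
  ∈-++⁺ˡ (∈-map⁺ (false ∷_) (∈-monomials≤ m (suc d) t t≤d))
∈-monomials≤ (suc m) (suc d) (true ∷ t)  (s≤s t≤d) =
  ∈-++⁺ʳ (map (false ∷_) (monomials≤ m (suc d))) (∈-map⁺ (true ∷_) (∈-monomials≤ m d t t≤d))

length-monomials≤ : ∀ m d → length (monomials≤ m d) ≤ suc m ^ d
length-monomials≤ zero    d       = ≤-reflexive (sym (^-zeroˡ d))
length-monomials≤ (suc m) zero    =
  ≤-trans (≤-reflexive (length-map (false ∷_) (monomials≤ m zero))) (length-monomials≤ m zero)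
length-monomials≤ (suc m) (suc d) = begin
  length (map (false ∷_) (monomials≤ m (suc d)) ++ˡ map (true ∷_) (monomials≤ m d))
    ≡⟨ length-++ (map (false ∷_) (monomials≤ m (suc d))) ⟩
  length (map (false ∷_) (monomials≤ m (suc d))) + length (map (true ∷_) (monomials≤ m d))
    ≡⟨ cong₂ _+_ (length-map (false ∷_) (monomials≤ m (suc d)))
                 (length-map (true ∷_) (monomials≤ m d)) ⟩
  length (monomials≤ m (suc d)) + length (monomials≤ m d)
    ≤⟨ +-mono-≤ (length-monomials≤ m (suc d)) (length-monomials≤ m d) ⟩
  suc m * suc m ^ d + suc m ^ d
    ≤⟨ +-mono-≤ (*-monoʳ-≤ (suc m) (^-monoˡ-≤ d (n≤1+n (suc m))))
                (^-monoˡ-≤ d (n≤1+n (suc m))) ⟩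
  suc m * suc (suc m) ^ d + suc (suc m) ^ d
    ≡⟨ +-comm (suc m * suc (suc m) ^ d) _ ⟩
  suc (suc m) ^ suc d ∎
  where open ≤-Reasoning

funToFin-cong : {f g : Fin a → Fin b} → (∀ i → f i ≡ g i) → funToFin f ≡ funToFin g
funToFin-cong {zero}  f≗g = refl
funToFin-cong {suc a} f≗g = cong₂ combine (f≗g zero) (funToFin-cong (f≗g ∘ suc))

open Inverse 2↔Bool using (to; from; strictlyInverseˡ; strictlyInverseʳ)

boolFunToFin : (Fin a → Bool) → Fin (2 ^ a)
boolFunToFin f = funToFin (from ∘ f)

finToBoolFun : Fin (2 ^ a) → (Fin a → Bool)
finToBoolFun i = to ∘ finToFun i

boolFunToFin-cong : {f g : Fin a → Bool} → (∀ i → f i ≡ g i) → boolFunToFin f ≡ boolFunToFin g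
boolFunToFin-cong f≗g = funToFin-cong (cong from ∘ f≗g)

finToBoolFun-boolFunToFin : ∀ (f : Fin a → Bool) i → finToBoolFun (boolFunToFin f) i ≡ f i
finToBoolFun-boolFunToFin f i =
  trans (cong to (finToFun-funToFin (from ∘ f) i)) (strictlyInverseˡ (f i))

boolFunToFin-finToBoolFun : ∀ (i : Fin (2 ^ a)) → boolFunToFin (finToBoolFun {a} i) ≡ i
boolFunToFin-finToBoolFun {a} i =
  trans (funToFin-cong {a} (strictlyInverseʳ ∘ finToFun {2} {a} i)) (funToFin-finToFin {a} i)

bitsToFin : Bits n → Fin (2 ^ n)
bitsToFin x = boolFunToFin (lookupᵛ x)

finToBits : Fin (2 ^ n) → Bits n
finToBits i = tabulate (finToBoolFun i)

bitsToFin-finToBits : ∀ (i : Fin (2 ^ n)) → bitsToFin (finToBits {n} i) ≡ i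
bitsToFin-finToBits {n} i =
  trans (boolFunToFin-cong {n} (lookup∘tabulate (finToBoolFun {n} i)))
        (boolFunToFin-finToBoolFun {n} i)

2^-cancel-≤ : 2 ^ a ≤ 2 ^ b → a ≤ b
2^-cancel-≤ {a} {b} 2^a≤2^b = begin
  a               ≡⟨ ⌊log₂[2^n]⌋≡n a ⟨
  ⌊log₂ 2 ^ a ⌋   ≤⟨ ⌊log₂⌋-mono-≤ 2^a≤2^b ⟩
  ⌊log₂ 2 ^ b ⌋   ≡⟨ ⌊log₂[2^n]⌋≡n b ⟩
  b               ∎
  where open ≤-Reasoning

boolFun-injective⇒≤ : (Φ : (Fin a → Bool) → (Fin b → Bool)) →
  (∀ f g → (∀ i → Φ f i ≡ Φ g i) → ∀ i → f i ≡ g i) → a ≤ b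
boolFun-injective⇒≤ {a} {b} Φ Φ-injective = 2^-cancel-≤ (injective⇒≤ h-injective)
  where
  h : Fin (2 ^ a) → Fin (2 ^ b)
  h i = boolFunToFin (Φ (finToBoolFun i))
  h-injective : ∀ {i j} → h i ≡ h j → i ≡ j
  h-injective {i} {j} hi≡hj = begin
    i                                 ≡⟨ boolFunToFin-finToBoolFun {a} i ⟨
    boolFunToFin (finToBoolFun {a} i) ≡⟨ boolFunToFin-cong (Φ-injective _ _ Φi≗Φj) ⟩
    boolFunToFin (finToBoolFun {a} j) ≡⟨ boolFunToFin-finToBoolFun {a} j ⟩
    j                                 ∎
    where
    open ≡-Reasoning
    Φi≗Φj : ∀ k → Φ (finToBoolFun i) k ≡ Φ (finToBoolFun j) k
    Φi≗Φj k = begin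
      Φ (finToBoolFun i) k      ≡⟨ finToBoolFun-boolFunToFin _ k ⟨
      finToBoolFun {b} (h i) k  ≡⟨ cong (λ c → finToBoolFun {b} c k) hi≡hj ⟩
      finToBoolFun {b} (h j) k  ≡⟨ finToBoolFun-boolFunToFin _ k ⟩
      Φ (finToBoolFun j) k      ∎

EQ-realizable⇒2^n≤[1+m]^d : Realizable n m d (EQ n) → 2 ^ n ≤ suc m ^ d
EQ-realizable⇒2^n≤[1+m]^d {n} {m} {d} (alice , bob , carol , carol-deg , EQ-carol) =
  ≤-trans (boolFun-injective⇒≤ Φ Φ-injective) (length-monomials≤ m d)
  where
  low : List (Monomial m)
  low = monomials≤ m d
  Φ : (Fin (2 ^ n) → Bool) → (Fin (length low) → Bool)
  Φ f i = moment (f ∘ bitsToFin) alice (lookup low i)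
  Φ-injective : ∀ f g → (∀ i → Φ f i ≡ Φ g i) → ∀ j → f j ≡ g j
  Φ-injective f g Φf≗Φg j = begin
    f j                             ≡⟨ cong f (bitsToFin-finToBits {n} j) ⟨
    f (bitsToFin (finToBits {n} j)) ≡⟨ low-moments-determine alice bob carol carol-deg EQ-carol
                                         (f ∘ bitsToFin) (g ∘ bitsToFin) same-low (finToBits j) ⟩
    g (bitsToFin (finToBits {n} j)) ≡⟨ cong g (bitsToFin-finToBits {n} j) ⟩
    g j                             ∎
    where
    open ≡-Reasoning
    same-low : ∀ t → monDeg t ≤ d →
      moment (f ∘ bitsToFin) alice t ≡ moment (g ∘ bitsToFin) alice t
    same-low t t≤d with t∈low ← ∈-monomials≤ m d t t≤d rewrite lookup-index t∈low =
      Φf≗Φg (index t∈low)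

1+n≤2^[⌊log₂n⌋+1] : ∀ n → suc n ≤ 2 ^ (⌊log₂ n ⌋ + 1)
1+n≤2^[⌊log₂n⌋+1] n with suc n ≤? 2 ^ (⌊log₂ n ⌋ + 1)
... | yes 1+n≤2^L = 1+n≤2^L
... | no  1+n≰2^L = contradiction (begin
  ⌊log₂ n ⌋ + 1                   ≡⟨ ⌊log₂[2^n]⌋≡n (⌊log₂ n ⌋ + 1) ⟨
  ⌊log₂ 2 ^ (⌊log₂ n ⌋ + 1) ⌋     ≤⟨ ⌊log₂⌋-mono-≤ (≤-pred (≰⇒> 1+n≰2^L)) ⟩
  ⌊log₂ n ⌋                       ∎) (m+1+n≰m ⌊log₂ n ⌋)
  where open ≤-Reasoning

proposition4p2 : Σ ℕ λ C → Σ ℕ λ n₀ → ∀ n m d → n₀ ≤ n → n ≤ m →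
    IsDf n m (EQ n) d → n ≤ C * d * (⌊log₂ m ⌋ + 1)
proposition4p2 = 1 , 0 , bound
  where
  bound : ∀ n m d → 0 ≤ n → n ≤ m → IsDf n m (EQ n) d → n ≤ 1 * d * (⌊log₂ m ⌋ + 1)
  bound n m d _ _ (realizable , _) = 2^-cancel-≤ (begin
    2 ^ n                          ≤⟨ EQ-realizable⇒2^n≤[1+m]^d realizable ⟩
    suc m ^ d                      ≤⟨ ^-monoˡ-≤ d (1+n≤2^[⌊log₂n⌋+1] m) ⟩
    (2 ^ (⌊log₂ m ⌋ + 1)) ^ d      ≡⟨ ^-*-assoc 2 (⌊log₂ m ⌋ + 1) d ⟩
    2 ^ ((⌊log₂ m ⌋ + 1) * d)      ≡⟨ cong (2 ^_) (*-comm (⌊log₂ m ⌋ + 1) d) ⟩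
    2 ^ (d * (⌊log₂ m ⌋ + 1))      ≡⟨ cong (λ c → 2 ^ (c * (⌊log₂ m ⌋ + 1))) (*-identityˡ d) ⟨
    2 ^ (1 * d * (⌊log₂ m ⌋ + 1))  ∎)
    where open ≤-Reasoning
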